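{- For each formula $\phi$ of $\mathcal{L}^2$ (i.e. not containing $\mathfrak{U}$) with free variables $\vec x,\vec X$, $\mathbf{RCA_0}$ proves \[\forall U\,\forall\vec X\,\forall\vec x\,\big((U\Vdash\phi)\leftrightarrow\phi\big).\]
   Context: $\mathcal{L}^2$ is the language of second-order arithmetic, containing for each second-order term $T$ and first-order term $t$ a term $T_t$ with $s\in T_t\leftrightarrow (t,s)\in T$ (fixed quantifier-free pairing). $\mathcal{L}^{\mathfrak{U}}$ is $\mathcal{L}^2$ plus a unary predicate $\mathfrak{U}$ on second-order terms. For a set $U$ write $U_n=\{s:(n,s)\in U\}$. $Ult(U)$: for every finite $F$, $\bigcap_{n\in F}U_n$ is infinite. $V\preceq U$: $Ult(V)$ and for every $n$ there is $m$ with $V_m\subseteq U_n$. The $\mathcal{L}^2$-formula $U\Vdash\phi$ is defined by recursion on the $\mathcal{L}^{\mathfrak{U}}$-formula $\phi$: atomic $\phi$ without $\mathfrak{U}$: $\phi$; $U\Vdash T\in\mathfrak{U}$: there is finite $F$ with $\bigcap_{n\in F}U_n\setminus T$ finite; $U\Vdash\phi\wedge\psi$: $(U\Vdash\phi)\wedge(U\Vdash\psi)$; $U\Vdash\phi\vee\psi$: $\forall V\preceq U\,\exists W\preceq V\,(W\Vdash\phi\vee W\Vdash\psi)$; $U\Vdash\neg\phi$: $\forall V\preceq U\,\neg(V\Vdash\phi)$; $U\Vdash\phi\rightarrow\psi$: $\forall V\preceq U\,(V\Vdash\phi\rightarrow V\Vdash\psi)$; $U\Vdash\forall x\phi$: $\forall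 x\,(U\Vdash\phi)$; $U\Vdash\exists x\phi$: $\forall V\preceq U\,\exists W\preceq V\,\exists x\,(W\Vdash\phi)$; $U\Vdash\forall X\phi$: $\forall X\,(U\Vdash\phi)$; $U\Vdash\exists X\phi$: $\forall V\preceq U\,\exists W\preceq V\,\exists X\,(W\Vdash\phi)$. The negation $\neg\phi$ may equivalently be regarded as $\phi\rightarrow 0\neq 1$, and $\vee,\exists$ as de Morgan abbreviations. -}

module Defs where

-- Variables are de Bruijn indices: first-order
-- variables and set variables form two separate index spaces.

open import Data.Nat using (ℕ; zero; suc)
open import Data.List using (List; []; _∷_; map)
open import Data.List.Membership.Propositional using (_∈_)
open import Function using (_∘_)

data Tm : Set where
  var  : ℕ → Tm
  `0   : Tm
  `1   : Tm
  _`+_ : Tm → Tm → Tm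
  _`*_ : Tm → Tm → Tm

infixl 6 _`+_
infixl 7 _`*_

data STm : Set where
  svar : ℕ → STm
  _at_ : STm → Tm → STm

pair : Tm → Tm → Tm
pair i j = (i `+ j) `* (i `+ j) `+ i

infix  4 _≐_ _≺_ _∈̇_
infixr 3 _∧̇_
infixr 2 _∨̇_
infixr 1 _⇒_ _⇔_

data Fm : Set where
  _≐_  : Tm → Tm → Fm
  _≺_  : Tm → Tm → Fm
  _∈̇_  : Tm → STm → Fm
  𝔘    : STm → Fm            -- T ∈ 𝔘
  ¬̇_   : Fm → Fm
  _∧̇_  : Fm → Fm → Fm
  _∨̇_  : Fm → Fm → Fm
  _⇒_  : Fm → Fm → Fm
  ∀̇    : Fm → Fm             -- binds first-order variable 0
  ∃̇    : Fm → Fm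
  ∀²   : Fm → Fm             -- binds set variable 0
  ∃²   : Fm → Fm

_⇔_ : Fm → Fm → Fm
φ ⇔ ψ = (φ ⇒ ψ) ∧̇ (ψ ⇒ φ)

data NoU : Fm → Set where
  eq   : ∀ {t s} → NoU (t ≐ s)
  lt   : ∀ {t s} → NoU (t ≺ s)
  mem  : ∀ {t T} → NoU (t ∈̇ T)
  neg  : ∀ {φ} → NoU φ → NoU (¬̇ φ)
  and  : ∀ {φ ψ} → NoU φ → NoU ψ → NoU (φ ∧̇ ψ)
  or   : ∀ {φ ψ} → NoU φ → NoU ψ → NoU (φ ∨̇ ψ)
  imp  : ∀ {φ ψ} → NoU φ → NoU ψ → NoU (φ ⇒ ψ)
  all  : ∀ {φ} → NoU φ → NoU (∀̇ φ)
  ex   : ∀ {φ} → NoU φ → NoU (∃̇ φ)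
  all² : ∀ {φ} → NoU φ → NoU (∀² φ)
  ex²  : ∀ {φ} → NoU φ → NoU (∃² φ)

substT : (ℕ → Tm) → Tm → Tm
substT σ (var i)  = σ i
substT σ `0       = `0
substT σ `1       = `1
substT σ (t `+ s) = substT σ t `+ substT σ s
substT σ (t `* s) = substT σ t `* substT σ s

substS : (ℕ → Tm) → (ℕ → STm) → STm → STm
substS σ τ (svar i) = τ i
substS σ τ (T at t) = substS σ τ T at substT σ t

wkN : Tm → Tm
wkN = substT (var ∘ suc)

wkNS : STm → STm
wkNS = substS (var ∘ suc) svar

wkS : STm → STm
wkS = substS var (svar ∘ suc)

liftN : (ℕ → Tm) → ℕ → Tm
liftN σ zero    = var zero
liftN σ (suc i) = wkN (σ i)

liftS : (ℕ → STm) → ℕ → STm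
liftS τ zero    = svar zero
liftS τ (suc i) = wkS (τ i)

substF : (ℕ → Tm) → (ℕ → STm) → Fm → Fm
substF σ τ (t ≐ s)  = substT σ t ≐ substT σ s
substF σ τ (t ≺ s)  = substT σ t ≺ substT σ s
substF σ τ (t ∈̇ T)  = substT σ t ∈̇ substS σ τ T
substF σ τ (𝔘 T)    = 𝔘 (substS σ τ T)
substF σ τ (¬̇ φ)    = ¬̇ substF σ τ φ
substF σ τ (φ ∧̇ ψ)  = substF σ τ φ ∧̇ substF σ τ ψ
substF σ τ (φ ∨̇ ψ)  = substF σ τ φ ∨̇ substF σ τ ψ
substF σ τ (φ ⇒ ψ)  = substF σ τ φ ⇒ substF σ τ ψ
substF σ τ (∀̇ φ)    = ∀̇ (substF (liftN σ) (wkNS ∘ τ) φ)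
substF σ τ (∃̇ φ)    = ∃̇ (substF (liftN σ) (wkNS ∘ τ) φ)
substF σ τ (∀² φ)   = ∀² (substF σ (liftS τ) φ)
substF σ τ (∃² φ)   = ∃² (substF σ (liftS τ) φ)

wkNF : Fm → Fm
wkNF = substF (var ∘ suc) svar

wkSF : Fm → Fm
wkSF = substF var (svar ∘ suc)

_▸_ : {A : Set} → A → (ℕ → A) → ℕ → A
(a ▸ f) zero    = a
(a ▸ f) (suc i) = f i

_[_] : Fm → Tm → Fm
φ [ t ] = substF (t ▸ var) svar φ

_[_]² : Fm → STm → Fm
φ [ T ]² = substF var (T ▸ svar) φ

-- bounded-set coding of finiteness: F ⊆ [0,b)  (F = set var 0, b = var 0)
-- Ult(U): for every finite F, ⋂_{n∈F} U_n is infinite (unbounded)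
Ult : STm → Fm
Ult U =
  ∀² (∀̇ ((∀̇ (var 0 ∈̇ svar 0 ⇒ var 0 ≺ var 1)) ⇒
        ∀̇ (∃̇ (var 1 ≺ var 0 ∧̇
              ∀̇ (var 0 ∈̇ svar 0 ⇒
                  pair (var 0) (var 1) ∈̇ wkNS (wkNS (wkNS (wkNS (wkS U)))))))))

-- V ⪯ U : Ult(V) ∧ ∀n ∃m  V_m ⊆ U_n
_⪯_ : STm → STm → Fm
V ⪯ U = Ult V ∧̇
  ∀̇ (∃̇ (∀̇ (pair (var 1) (var 0) ∈̇ wkNS (wkNS (wkNS V)) ⇒
            pair (var 2) (var 0) ∈̇ wkNS (wkNS (wkNS U)))))

-- U ⊩ T ∈ 𝔘 : there is finite F with ⋂_{n∈F} U_n \ T finite (bounded)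
forceU : STm → STm → Fm
forceU U T =
  ∃² (∃̇ ((∀̇ (var 0 ∈̇ svar 0 ⇒ var 0 ≺ var 1)) ∧̇
        ∃̇ (∀̇ (((∀̇ (var 0 ∈̇ svar 0 ⇒
                     pair (var 0) (var 1) ∈̇ wkNS (wkNS (wkNS (wkNS (wkS U))))))
                ∧̇ ¬̇ (var 0 ∈̇ wkNS (wkNS (wkNS (wkS T)))))
               ⇒ var 0 ≺ var 1))))

-- force φ σ τ U : the formula U ⊩ φ, where the free variables of φ are
-- interpreted in the current context via σ, τ, and U is a set term of
-- the current context.
force : Fm → (ℕ → Tm) → (ℕ → STm) → STm → Fm
force (t ≐ s) σ τ U = substF σ τ (t ≐ s)
force (t ≺ s) σ τ U = substF σ τ (t ≺ s)
force (t ∈̇ T) σ τ U = substF σ τ (t ∈̇ T)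
force (𝔘 T)   σ τ U = forceU U (substS σ τ T)
force (φ ∧̇ ψ) σ τ U = force φ σ τ U ∧̇ force ψ σ τ U
force (φ ∨̇ ψ) σ τ U =
  ∀² (svar 0 ⪯ wkS U ⇒
      ∃² (svar 0 ⪯ svar 1 ∧̇
          (force φ σ (wkS ∘ wkS ∘ τ) (svar 0) ∨̇
           force ψ σ (wkS ∘ wkS ∘ τ) (svar 0))))
force (¬̇ φ) σ τ U =
  ∀² (svar 0 ⪯ wkS U ⇒ ¬̇ force φ σ (wkS ∘ τ) (svar 0))
force (φ ⇒ ψ) σ τ U =
  ∀² (svar 0 ⪯ wkS U ⇒
      (force φ σ (wkS ∘ τ) (svar 0) ⇒ force ψ σ (wkS ∘ τ) (svar 0)))
force (∀̇ φ) σ τ U = ∀̇ (force φ (liftN σ) (wkNS ∘ τ) (wkNS U))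
force (∃̇ φ) σ τ U =
  ∀² (svar 0 ⪯ wkS U ⇒
      ∃² (svar 0 ⪯ svar 1 ∧̇
          ∃̇ (force φ (liftN σ) (wkNS ∘ wkS ∘ wkS ∘ τ) (svar 0))))
force (∀² φ) σ τ U = ∀² (force φ σ (liftS τ) (wkS U))
force (∃² φ) σ τ U =
  ∀² (svar 0 ⪯ wkS U ⇒
      ∃² (svar 0 ⪯ svar 1 ∧̇
          ∃² (force φ σ (liftS (wkS ∘ wkS ∘ τ)) (svar 1))))

infix 5 _⊩_
_⊩_ : STm → Fm → Fm
U ⊩ φ = force φ var svar U

data Bounded : Fm → Set where
  eq   : ∀ {t s} → Bounded (t ≐ s)
  lt   : ∀ {t s} → Bounded (t ≺ s)
  mem  : ∀ {t T} → Bounded (t ∈̇ T)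
  neg  : ∀ {φ} → Bounded φ → Bounded (¬̇ φ)
  and  : ∀ {φ ψ} → Bounded φ → Bounded ψ → Bounded (φ ∧̇ ψ)
  or   : ∀ {φ ψ} → Bounded φ → Bounded ψ → Bounded (φ ∨̇ ψ)
  imp  : ∀ {φ ψ} → Bounded φ → Bounded ψ → Bounded (φ ⇒ ψ)
  ball : ∀ {t φ} → Bounded φ → Bounded (∀̇ (var 0 ≺ wkN t ⇒ φ))
  bex  : ∀ {t φ} → Bounded φ → Bounded (∃̇ (var 0 ≺ wkN t ∧̇ φ))

data Σ⁰₁ : Fm → Set where
  sig : ∀ {θ} → Bounded θ → Σ⁰₁ (∃̇ θ)

data Π⁰₁ : Fm → Set where
  pi : ∀ {θ} → Bounded θ → Π⁰₁ (∀̇ θ)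

-- Axioms of RCA₀ (free variables are implicitly universally quantified)

x₀ x₁ : Tm
x₀ = var 0
x₁ = var 1

sucSub : ℕ → Tm
sucSub zero    = var 0 `+ `1
sucSub (suc i) = var (suc i)

data RCA₀ : Fm → Set where
  ax-succ≢0  : RCA₀ (¬̇ (x₀ `+ `1 ≐ `0))
  ax-succInj : RCA₀ (x₀ `+ `1 ≐ x₁ `+ `1 ⇒ x₀ ≐ x₁)
  ax-+0      : RCA₀ (x₀ `+ `0 ≐ x₀)
  ax-+suc    : RCA₀ (x₀ `+ (x₁ `+ `1) ≐ (x₀ `+ x₁) `+ `1)
  ax-*0      : RCA₀ (x₀ `* `0 ≐ `0)
  ax-*suc    : RCA₀ (x₀ `* (x₁ `+ `1) ≐ (x₀ `* x₁) `+ x₀)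
  ax-<0      : RCA₀ (¬̇ (x₀ ≺ `0))
  ax-<suc    : RCA₀ (x₀ ≺ x₁ `+ `1 ⇔ (x₀ ≺ x₁ ∨̇ x₀ ≐ x₁))
  ax-at      : RCA₀ (x₀ ∈̇ (svar 0 at x₁) ⇔ pair x₁ x₀ ∈̇ svar 0)
  ax-ind     : ∀ {φ} → Σ⁰₁ φ →
               RCA₀ ((φ [ `0 ] ∧̇ ∀̇ (φ ⇒ substF sucSub svar φ)) ⇒ ∀̇ φ)
  -- Δ⁰₁ comprehension (X, the bound set variable, is not free in φ)
  ax-comp    : ∀ {φ ψ} → Σ⁰₁ φ → Π⁰₁ ψ →
               RCA₀ (∀̇ (φ ⇔ ψ) ⇒ ∃² (∀̇ (x₀ ∈̇ svar 0 ⇔ wkSF φ)))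

infix 0 _⊢_

data _⊢_ (Γ : List Fm) : Fm → Set where
  hyp  : ∀ {φ} → φ ∈ Γ → Γ ⊢ φ
  ax   : ∀ {φ} → RCA₀ φ → Γ ⊢ φ
  ∧I   : ∀ {φ ψ} → Γ ⊢ φ → Γ ⊢ ψ → Γ ⊢ φ ∧̇ ψ
  ∧E₁  : ∀ {φ ψ} → Γ ⊢ φ ∧̇ ψ → Γ ⊢ φ
  ∧E₂  : ∀ {φ ψ} → Γ ⊢ φ ∧̇ ψ → Γ ⊢ ψ
  ∨I₁  : ∀ {φ ψ} → Γ ⊢ φ → Γ ⊢ φ ∨̇ ψ
  ∨I₂  : ∀ {φ ψ} → Γ ⊢ ψ → Γ ⊢ φ ∨̇ ψ
  ∨E   : ∀ {φ ψ χ} → Γ ⊢ φ ∨̇ ψ → (φ ∷ Γ) ⊢ χ → (ψ ∷ Γ) ⊢ χ → Γ ⊢ χ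
  ⇒I   : ∀ {φ ψ} → (φ ∷ Γ) ⊢ ψ → Γ ⊢ φ ⇒ ψ
  ⇒E   : ∀ {φ ψ} → Γ ⊢ φ ⇒ ψ → Γ ⊢ φ → Γ ⊢ ψ
  ¬I   : ∀ {φ ψ} → (φ ∷ Γ) ⊢ ψ → (φ ∷ Γ) ⊢ ¬̇ ψ → Γ ⊢ ¬̇ φ
  ¬E   : ∀ {φ ψ} → Γ ⊢ φ → Γ ⊢ ¬̇ φ → Γ ⊢ ψ
  dne  : ∀ {φ} → Γ ⊢ ¬̇ ¬̇ φ → Γ ⊢ φ
  ∀I   : ∀ {φ} → map wkNF Γ ⊢ φ → Γ ⊢ ∀̇ φ
  ∀E   : ∀ {φ} (t : Tm) → Γ ⊢ ∀̇ φ → Γ ⊢ φ [ t ]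
  ∃I   : ∀ {φ} (t : Tm) → Γ ⊢ φ [ t ] → Γ ⊢ ∃̇ φ
  ∃E   : ∀ {φ ψ} → Γ ⊢ ∃̇ φ → (φ ∷ map wkNF Γ) ⊢ wkNF ψ → Γ ⊢ ψ
  ∀²I  : ∀ {φ} → map wkSF Γ ⊢ φ → Γ ⊢ ∀² φ
  ∀²E  : ∀ {φ} (T : STm) → Γ ⊢ ∀² φ → Γ ⊢ φ [ T ]²
  ∃²I  : ∀ {φ} (T : STm) → Γ ⊢ φ [ T ]² → Γ ⊢ ∃² φ
  ∃²E  : ∀ {φ ψ} → Γ ⊢ ∃² φ → (φ ∷ map wkSF Γ) ⊢ wkSF ψ → Γ ⊢ ψ
  ≐refl : ∀ {t} → Γ ⊢ t ≐ t
  ≐subst : ∀ {φ t s} → Γ ⊢ t ≐ s → Γ ⊢ φ [ t ] → Γ ⊢ φ [ s ]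

RCA₀⊢_ : Fm → Set
RCA₀⊢ φ = [] ⊢ φ

-- Induction on φ, for an arbitrary forcing set U in any context containing
-- Ult U and an arbitrary interpretation σ, τ of the free variables.
-- Atomic formulas, ∧, ∀ and ∀² are forced componentwise.  The other clauses
-- quantify over conditions below U: going from U ⊩ φ to φ one takes V := U,
-- allowed because Ult U gives U ⪯ U; going back one takes W := V, allowed
-- because every V ⪯ U again satisfies Ult.  With the induction hypothesis
-- applied at those conditions each clause collapses to its connective.  The
-- de Bruijn bookkeeping rests on one fact: forcing commutes with substitution.

module Submission where

open import Defs
open import Data.Nat using (ℕ; zero; suc)
open import Data.List using (List; _∷_; map)
open import Data.List.Membership.Propositional using (_∈_)
open import Data.List.Membership.Propositional.Properties using (∈-map⁺)
open import Data.List.Relation.Unary.Any using (here; there)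
open import Function using (_∘_)
open import Relation.Binary.PropositionalEquality hiding ([_])

variable
  σ σ′ σ″ : ℕ → Tm
  τ τ′ τ″ : ℕ → STm
  Γ : List Fm
  A B C C′ φ ψ χ : Fm
  U : STm

substT-id : σ ≗ var → ∀ t → substT σ t ≡ t
substT-id h (var i)  = h i
substT-id h `0       = refl
substT-id h `1       = refl
substT-id h (t `+ s) = cong₂ _`+_ (substT-id h t) (substT-id h s)
substT-id h (t `* s) = cong₂ _`*_ (substT-id h t) (substT-id h s)

substT-var : ∀ t → substT var t ≡ t
substT-var = substT-id (λ _ → refl)

substT-∘ : substT σ′ ∘ σ ≗ σ″ → ∀ t → substT σ′ (substT σ t) ≡ substT σ″ t
substT-∘ h (var i)  = h i
substT-∘ h `0       = refl
substT-∘ h `1       = refl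
substT-∘ h (t `+ s) = cong₂ _`+_ (substT-∘ h t) (substT-∘ h s)
substT-∘ h (t `* s) = cong₂ _`*_ (substT-∘ h t) (substT-∘ h s)

substS-id : σ ≗ var → τ ≗ svar → ∀ T → substS σ τ T ≡ T
substS-id hσ hτ (svar i) = hτ i
substS-id hσ hτ (T at t) = cong₂ _at_ (substS-id hσ hτ T) (substT-id hσ t)

substS-∘ : substT σ′ ∘ σ ≗ σ″ → substS σ′ τ′ ∘ τ ≗ τ″ →
           ∀ T → substS σ′ τ′ (substS σ τ T) ≡ substS σ″ τ″ T
substS-∘ hσ hτ (svar i) = hτ i
substS-∘ hσ hτ (T at t) = cong₂ _at_ (substS-∘ hσ hτ T) (substT-∘ hσ t)

wkN-comm : ∀ σ t → substT (liftN σ) (wkN t) ≡ wkN (substT σ t)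
wkN-comm σ t = trans (substT-∘ (λ _ → refl) t) (sym (substT-∘ (λ _ → refl) t))

wkNS-comm : ∀ σ τ T → substS (liftN σ) (wkNS ∘ τ) (wkNS T) ≡ wkNS (substS σ τ T)
wkNS-comm σ τ T =
  trans (substS-∘ (λ _ → refl) (λ _ → refl) T) (sym (substS-∘ (λ _ → refl) (λ _ → refl) T))

wkS-comm : ∀ σ τ T → substS σ (liftS τ) (wkS T) ≡ wkS (substS σ τ T)
wkS-comm σ τ T =
  trans (substS-∘ (λ _ → refl) (λ _ → refl) T) (sym (substS-∘ (substT-var ∘ σ) (λ _ → refl) T))

wkS-inst : ∀ U T → substS var (U ▸ svar) (wkS T) ≡ T
wkS-inst U T = trans (substS-∘ (λ _ → refl) (λ _ → refl) T) (substS-id (λ _ → refl) (λ _ → refl) T)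

liftN-id : σ ≗ var → liftN σ ≗ var
liftN-id h zero    = refl
liftN-id h (suc i) = cong wkN (h i)

liftS-id : τ ≗ svar → liftS τ ≗ svar
liftS-id h zero    = refl
liftS-id h (suc i) = cong wkS (h i)

liftN-∘ : substT σ′ ∘ σ ≗ σ″ → substT (liftN σ′) ∘ liftN σ ≗ liftN σ″
liftN-∘ h zero             = refl
liftN-∘ {σ′ = σ′} {σ = σ} h (suc i) = trans (wkN-comm σ′ (σ i)) (cong wkN (h i))

wkNS-∘ : ∀ τ → substS σ′ τ′ ∘ τ ≗ τ″ →
         substS (liftN σ′) (wkNS ∘ τ′) ∘ (wkNS ∘ τ) ≗ wkNS ∘ τ″
wkNS-∘ {σ′ = σ′} {τ′ = τ′} τ h i = trans (wkNS-comm σ′ τ′ (τ i)) (cong wkNS (h i))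

wkS-∘ : ∀ τ → substS σ′ τ′ ∘ τ ≗ τ″ →
        substS σ′ (liftS τ′) ∘ (wkS ∘ τ) ≗ wkS ∘ τ″
wkS-∘ {σ′ = σ′} {τ′ = τ′} τ h i = trans (wkS-comm σ′ τ′ (τ i)) (cong wkS (h i))

liftS-∘ : substS σ′ τ′ ∘ τ ≗ τ″ → substS σ′ (liftS τ′) ∘ liftS τ ≗ liftS τ″
liftS-∘ h zero             = refl
liftS-∘ {τ = τ} h (suc i) = wkS-∘ τ h i

substF-id : σ ≗ var → τ ≗ svar → ∀ φ → substF σ τ φ ≡ φ
substF-id hσ hτ (t ≐ s)  = cong₂ _≐_ (substT-id hσ t) (substT-id hσ s)
substF-id hσ hτ (t ≺ s)  = cong₂ _≺_ (substT-id hσ t) (substT-id hσ s)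
substF-id hσ hτ (t ∈̇ T)  = cong₂ _∈̇_ (substT-id hσ t) (substS-id hσ hτ T)
substF-id hσ hτ (𝔘 T)    = cong 𝔘 (substS-id hσ hτ T)
substF-id hσ hτ (¬̇ φ)    = cong ¬̇_ (substF-id hσ hτ φ)
substF-id hσ hτ (φ ∧̇ ψ)  = cong₂ _∧̇_ (substF-id hσ hτ φ) (substF-id hσ hτ ψ)
substF-id hσ hτ (φ ∨̇ ψ)  = cong₂ _∨̇_ (substF-id hσ hτ φ) (substF-id hσ hτ ψ)
substF-id hσ hτ (φ ⇒ ψ)  = cong₂ _⇒_ (substF-id hσ hτ φ) (substF-id hσ hτ ψ)
substF-id hσ hτ (∀̇ φ)    = cong ∀̇ (substF-id (liftN-id hσ) (λ i → cong wkNS (hτ i)) φ)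
substF-id hσ hτ (∃̇ φ)    = cong ∃̇ (substF-id (liftN-id hσ) (λ i → cong wkNS (hτ i)) φ)
substF-id hσ hτ (∀² φ)   = cong ∀² (substF-id hσ (liftS-id hτ) φ)
substF-id hσ hτ (∃² φ)   = cong ∃² (substF-id hσ (liftS-id hτ) φ)

substF-∘ : substT σ′ ∘ σ ≗ σ″ → substS σ′ τ′ ∘ τ ≗ τ″ →
           ∀ φ → substF σ′ τ′ (substF σ τ φ) ≡ substF σ″ τ″ φ
substF-∘ hσ hτ (t ≐ s)  = cong₂ _≐_ (substT-∘ hσ t) (substT-∘ hσ s)
substF-∘ hσ hτ (t ≺ s)  = cong₂ _≺_ (substT-∘ hσ t) (substT-∘ hσ s)
substF-∘ hσ hτ (t ∈̇ T)  = cong₂ _∈̇_ (substT-∘ hσ t) (substS-∘ hσ hτ T)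
substF-∘ hσ hτ (𝔘 T)    = cong 𝔘 (substS-∘ hσ hτ T)
substF-∘ hσ hτ (¬̇ φ)    = cong ¬̇_ (substF-∘ hσ hτ φ)
substF-∘ hσ hτ (φ ∧̇ ψ)  = cong₂ _∧̇_ (substF-∘ hσ hτ φ) (substF-∘ hσ hτ ψ)
substF-∘ hσ hτ (φ ∨̇ ψ)  = cong₂ _∨̇_ (substF-∘ hσ hτ φ) (substF-∘ hσ hτ ψ)
substF-∘ hσ hτ (φ ⇒ ψ)  = cong₂ _⇒_ (substF-∘ hσ hτ φ) (substF-∘ hσ hτ ψ)
substF-∘ {τ = τ} hσ hτ (∀̇ φ) = cong ∀̇ (substF-∘ (liftN-∘ hσ) (wkNS-∘ τ hτ) φ)
substF-∘ {τ = τ} hσ hτ (∃̇ φ) = cong ∃̇ (substF-∘ (liftN-∘ hσ) (wkNS-∘ τ hτ) φ)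
substF-∘ hσ hτ (∀² φ)   = cong ∀² (substF-∘ hσ (liftS-∘ hτ) φ)
substF-∘ hσ hτ (∃² φ)   = cong ∃² (substF-∘ hσ (liftS-∘ hτ) φ)

wkSF-subst : ∀ σ τ φ → wkSF (substF σ τ φ) ≡ substF σ (wkS ∘ τ) φ
wkSF-subst σ τ = substF-∘ (substT-var ∘ σ) (λ _ → refl)

inst-var0 : ∀ φ → substF (liftN (var ∘ suc)) (wkNS ∘ svar) φ [ var 0 ] ≡ φ
inst-var0 φ = trans (substF-∘ (λ { zero → refl ; (suc i) → refl }) (λ _ → refl) φ)
                    (substF-id (λ _ → refl) (λ _ → refl) φ)

inst-svar0 : ∀ φ → substF var (liftS (svar ∘ suc)) φ [ svar 0 ]² ≡ φ
inst-svar0 φ = trans (substF-∘ (λ _ → refl) (λ { zero → refl ; (suc i) → refl }) φ)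
                     (substF-id (λ _ → refl) (λ _ → refl) φ)

-- Ult U, V ⪯ U and forceU U T are definitionally Ult (svar 0), svar 0 ⪯ svar 1
-- and forceU (svar 0) (svar 1) with U, V, T substituted for the set variables,
-- so commuting them with a substitution is an instance of substF-∘.
Ult-subst : ∀ σ τ U → substF σ τ (Ult U) ≡ Ult (substS σ τ U)
Ult-subst σ τ U = substF-∘ {σ = var} {τ = U ▸ svar} (λ _ → refl) (λ _ → refl) (Ult (svar 0))

⪯-subst : ∀ σ τ V U → substF σ τ (V ⪯ U) ≡ (substS σ τ V ⪯ substS σ τ U)
⪯-subst σ τ V U =
  substF-∘ {σ = var} {τ = V ▸ (U ▸ svar)} (λ _ → refl) (λ _ → refl) (svar 0 ⪯ svar 1)

forceU-subst : ∀ σ τ U T → substF σ τ (forceU U T) ≡ forceU (substS σ τ U) (substS σ τ T)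
forceU-subst σ τ U T =
  substF-∘ {σ = var} {τ = U ▸ (T ▸ svar)} (λ _ → refl) (λ _ → refl) (forceU (svar 0) (svar 1))

-- ∀V ⪯ U. B  and  ∀V ⪯ U. ∃W ⪯ V. C : V is set variable 0 of B, and W, V are
-- set variables 0, 1 of C.
∀⪯ : STm → Fm → Fm
∀⪯ U B = ∀² (svar 0 ⪯ wkS U ⇒ B)

Dense : STm → Fm → Fm
Dense U C = ∀⪯ U (∃² (svar 0 ⪯ svar 1 ∧̇ C))

∀⪯-subst : ∀ σ τ U B → substF σ τ (∀⪯ U B) ≡ ∀⪯ (substS σ τ U) (substF σ (liftS τ) B)
∀⪯-subst σ τ U B =
  cong (λ A → ∀² (A ⇒ substF σ (liftS τ) B))
       (trans (⪯-subst σ (liftS τ) (svar 0) (wkS U)) (cong (svar 0 ⪯_) (wkS-comm σ τ U)))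

Dense-subst : ∀ σ τ U C →
              substF σ τ (Dense U C) ≡ Dense (substS σ τ U) (substF σ (liftS (liftS τ)) C)
Dense-subst σ τ U C = ∀⪯-subst σ τ U (∃² (svar 0 ⪯ svar 1 ∧̇ C))

force-subst : ∀ φ → substT σ′ ∘ σ ≗ σ″ → substS σ′ τ′ ∘ τ ≗ τ″ → ∀ U →
              substF σ′ τ′ (force φ σ τ U) ≡ force φ σ″ τ″ (substS σ′ τ′ U)
force-subst {σ = σ} {τ = τ} (t ≐ s) hσ hτ U = substF-∘ {σ = σ} {τ = τ} hσ hτ (t ≐ s)
force-subst {σ = σ} {τ = τ} (t ≺ s) hσ hτ U = substF-∘ {σ = σ} {τ = τ} hσ hτ (t ≺ s)
force-subst {σ = σ} {τ = τ} (t ∈̇ T) hσ hτ U = substF-∘ {σ = σ} {τ = τ} hσ hτ (t ∈̇ T)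
force-subst {σ′ = σ′} {σ = σ} {τ′ = τ′} {τ = τ} (𝔘 T) hσ hτ U =
  trans (forceU-subst σ′ τ′ U (substS σ τ T)) (cong (forceU (substS σ′ τ′ U)) (substS-∘ hσ hτ T))
force-subst {σ′ = σ′} {τ′ = τ′} {τ = τ} (¬̇ φ) hσ hτ U =
  trans (∀⪯-subst σ′ τ′ U _)
        (cong (∀⪯ (substS σ′ τ′ U) ∘ ¬̇_) (force-subst φ hσ (wkS-∘ τ hτ) (svar 0)))
force-subst (φ ∧̇ ψ) hσ hτ U = cong₂ _∧̇_ (force-subst φ hσ hτ U) (force-subst ψ hσ hτ U)
force-subst {σ′ = σ′} {τ′ = τ′} {τ = τ} (φ ∨̇ ψ) hσ hτ U =
  trans (Dense-subst σ′ τ′ U _)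
        (cong₂ (λ A B → Dense (substS σ′ τ′ U) (A ∨̇ B))
               (force-subst φ hσ hτ₂ (svar 0)) (force-subst ψ hσ hτ₂ (svar 0)))
  where hτ₂ = wkS-∘ (wkS ∘ τ) (wkS-∘ τ hτ)
force-subst {σ′ = σ′} {τ′ = τ′} {τ = τ} (φ ⇒ ψ) hσ hτ U =
  trans (∀⪯-subst σ′ τ′ U _)
        (cong₂ (λ A B → ∀⪯ (substS σ′ τ′ U) (A ⇒ B))
               (force-subst φ hσ (wkS-∘ τ hτ) (svar 0)) (force-subst ψ hσ (wkS-∘ τ hτ) (svar 0)))
force-subst {σ′ = σ′} {σ″ = σ″} {τ′ = τ′} {τ = τ} {τ″ = τ″} (∀̇ φ) hσ hτ U =
  cong ∀̇ (trans (force-subst φ (liftN-∘ hσ) (wkNS-∘ τ hτ) (wkNS U))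
                (cong (force φ (liftN σ″) (wkNS ∘ τ″)) (wkNS-comm σ′ τ′ U)))
force-subst {σ′ = σ′} {τ′ = τ′} {τ = τ} (∃̇ φ) hσ hτ U =
  trans (Dense-subst σ′ τ′ U _)
        (cong (Dense (substS σ′ τ′ U) ∘ ∃̇)
              (force-subst φ (liftN-∘ hσ) (wkNS-∘ (wkS ∘ wkS ∘ τ) hτ₂) (svar 0)))
  where hτ₂ = wkS-∘ (wkS ∘ τ) (wkS-∘ τ hτ)
force-subst {σ′ = σ′} {σ″ = σ″} {τ′ = τ′} {τ″ = τ″} (∀² φ) hσ hτ U =
  cong ∀² (trans (force-subst φ hσ (liftS-∘ hτ) (wkS U))
                 (cong (force φ σ″ (liftS τ″)) (wkS-comm σ′ τ′ U)))
force-subst {σ′ = σ′} {τ′ = τ′} {τ = τ} (∃² φ) hσ hτ U =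
  trans (Dense-subst σ′ τ′ U _)
        (cong (Dense (substS σ′ τ′ U) ∘ ∃²)
              (force-subst φ hσ (liftS-∘ (wkS-∘ (wkS ∘ τ) (wkS-∘ τ hτ))) (svar 1)))

force-inst : ∀ φ U → substF var (U ▸ svar) (force φ σ (wkS ∘ τ) (svar 0)) ≡ force φ σ τ U
force-inst {σ = σ} {τ = τ} φ U = force-subst φ (substT-var ∘ σ) (wkS-inst U ∘ τ) (svar 0)

-- The set variable V of a Dense body is eliminated by V := U when the clause is
-- used and by W := V when it is proved.
wkS²-inst-at₁ : ∀ (τ : ℕ → STm) U → substS var (liftS (U ▸ svar)) ∘ (wkS ∘ wkS ∘ τ) ≗ wkS ∘ τ
wkS²-inst-at₁ τ U = wkS-∘ (wkS ∘ τ) (λ i → wkS-inst U (τ i))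

wkS²-inst-at₀ : ∀ (τ : ℕ → STm) → substS var (svar 0 ▸ svar) ∘ (wkS ∘ wkS ∘ τ) ≗ wkS ∘ τ
wkS²-inst-at₀ τ i = wkS-inst (svar 0) (wkS (τ i))

cast : A ≡ B → Γ ⊢ A → Γ ⊢ B
cast refl d = d

#0 : (A ∷ Γ) ⊢ A
#0 = hyp (here refl)

#1 : (B ∷ A ∷ Γ) ⊢ A
#1 = hyp (there (here refl))

#2 : (C ∷ B ∷ A ∷ Γ) ⊢ A
#2 = hyp (there (there (here refl)))

#3 : (C′ ∷ C ∷ B ∷ A ∷ Γ) ⊢ A
#3 = hyp (there (there (there (here refl))))

⇔I : (A ∷ Γ) ⊢ B → (B ∷ Γ) ⊢ A → Γ ⊢ A ⇔ B
⇔I d e = ∧I (⇒I d) (⇒I e)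

⇔E₁ : Γ ⊢ A ⇔ B → Γ ⊢ A → Γ ⊢ B
⇔E₁ d = ⇒E (∧E₁ d)

⇔E₂ : Γ ⊢ A ⇔ B → Γ ⊢ B → Γ ⊢ A
⇔E₂ d = ⇒E (∧E₂ d)

∀E₀ : Γ ⊢ wkNF (∀̇ φ) → Γ ⊢ φ
∀E₀ {φ = φ} d = cast (inst-var0 φ) (∀E (var 0) d)

∃I₀ : Γ ⊢ φ → Γ ⊢ wkNF (∃̇ φ)
∃I₀ {φ = φ} d = ∃I (var 0) (cast (sym (inst-var0 φ)) d)

∀²E₀ : Γ ⊢ wkSF (∀² φ) → Γ ⊢ φ
∀²E₀ {φ = φ} d = cast (inst-svar0 φ) (∀²E (svar 0) d)

∃²I₀ : Γ ⊢ φ → Γ ⊢ wkSF (∃² φ)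
∃²I₀ {φ = φ} d = ∃²I (svar 0) (cast (sym (inst-svar0 φ)) d)

Ult-wkN : ∀ U → Ult U ∈ Γ → Ult (wkNS U) ∈ map wkNF Γ
Ult-wkN {Γ = Γ} U m = subst (_∈ map wkNF Γ) (Ult-subst (var ∘ suc) svar U) (∈-map⁺ wkNF m)

Ult-wkS : ∀ U → Ult U ∈ Γ → Ult (wkS U) ∈ map wkSF Γ
Ult-wkS {Γ = Γ} U m = subst (_∈ map wkSF Γ) (Ult-subst var (svar ∘ suc) U) (∈-map⁺ wkSF m)

⪯-inst : ∀ U V → (svar 0 ⪯ wkS U) [ V ]² ≡ (V ⪯ U)
⪯-inst U V = trans (⪯-subst var (V ▸ svar) (svar 0) (wkS U)) (cong (V ⪯_) (wkS-inst V U))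

⪯-refl : ∀ U → Γ ⊢ Ult U → Γ ⊢ U ⪯ U
⪯-refl U u = ∧I u (∀I (∃I (var 0) (∀I (⇒I #0))))

∀⪯I : ∀ U → (Ult (svar 0) ∷ svar 0 ⪯ wkS U ∷ map wkSF Γ) ⊢ B → Γ ⊢ ∀⪯ U B
∀⪯I U d = ∀²I (⇒I (⇒E (⇒I d) (∧E₁ #0)))

∀⪯E-self : ∀ U → Γ ⊢ Ult U → Γ ⊢ ∀⪯ U B → Γ ⊢ B [ U ]²
∀⪯E-self {B = B} U u d = ⇒E (cast (cong (_⇒ B [ U ]²) (⪯-inst U U)) (∀²E U d)) (⪯-refl U u)

Dense-intro : ∀ U → substF var (svar 0 ▸ svar) C ≡ C′ →
              (Ult (svar 0) ∷ svar 0 ⪯ wkS U ∷ map wkSF Γ) ⊢ C′ → Γ ⊢ Dense U C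
Dense-intro U e d =
  ∀⪯I U (∃²I (svar 0) (cast (sym (cong₂ _∧̇_ (⪯-inst (svar 0) (svar 0)) e))
                             (∧I (⪯-refl (svar 0) #0) d)))

-- The conjunction stays in the context of the continuation: the calculus has
-- no weakening.
Dense-elim : ∀ U → Γ ⊢ Ult U → substF var (liftS (U ▸ svar)) C ≡ C′ → Γ ⊢ Dense U C →
             (C′ ∷ Ult (svar 0) ∷ (svar 0 ⪯ wkS U ∧̇ C′) ∷ map wkSF Γ) ⊢ wkSF χ → Γ ⊢ χ
Dense-elim U u e d k =
  ∃²E (cast (cong₂ (λ A B → ∃² (A ∧̇ B)) (⪯-subst var (liftS (U ▸ svar)) (svar 0) (svar 1)) e)
            (∀⪯E-self U u d))
      (⇒E (⇒E (⇒I (⇒I k)) (∧E₁ (∧E₁ #0))) (∧E₂ #0))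

Agreement : Fm → Set
Agreement φ = ∀ Γ σ τ U → Ult U ∈ Γ → Γ ⊢ force φ σ τ U ⇔ substF σ τ φ

forced⇒ : Agreement φ → ∀ U → Ult U ∈ Γ → Γ ⊢ force φ σ τ U → Γ ⊢ substF σ τ φ
forced⇒ ih U m = ⇔E₁ (ih _ _ _ _ m)

⇒forced : Agreement φ → ∀ U → Ult U ∈ Γ → Γ ⊢ substF σ τ φ → Γ ⊢ force φ σ τ U
⇒forced ih U m = ⇔E₂ (ih _ _ _ _ m)

agree-∧ : Agreement φ → Agreement ψ → Agreement (φ ∧̇ ψ)
agree-∧ ihφ ihψ Γ σ τ U m = ⇔I
  (∧I (forced⇒ ihφ U (there m) (∧E₁ #0)) (forced⇒ ihψ U (there m) (∧E₂ #0)))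
  (∧I (⇒forced ihφ U (there m) (∧E₁ #0)) (⇒forced ihψ U (there m) (∧E₂ #0)))

agree-¬ : Agreement φ → Agreement (¬̇ φ)
agree-¬ {φ} ih Γ σ τ U m = ⇔I
  (¬I (⇒forced ih U (there (there m)) #0)
      (cast (cong ¬̇_ (force-inst φ U)) (∀⪯E-self U (hyp (there (there m))) #1)))
  (∀⪯I U (¬I (forced⇒ ih (svar 0) (there (here refl)) #0) (cast (wkSF-subst σ τ (¬̇ φ)) #3)))

agree-⇒ : Agreement φ → Agreement ψ → Agreement (φ ⇒ ψ)
agree-⇒ {φ} {ψ} ihφ ihψ Γ σ τ U m = ⇔I
  (⇒I (forced⇒ ihψ U m₂
         (⇒E (cast (cong₂ _⇒_ (force-inst φ U) (force-inst ψ U)) (∀⪯E-self U (hyp m₂) #1))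
             (⇒forced ihφ U m₂ #0))))
  (∀⪯I U (⇒I (⇒forced ihψ (svar 0) (there (here refl))
                (⇒E (cast (wkSF-subst σ τ (φ ⇒ ψ)) #3)
                    (forced⇒ ihφ (svar 0) (there (here refl)) #0)))))
  where m₂ = there (there m)

agree-∨ : Agreement φ → Agreement ψ → Agreement (φ ∨̇ ψ)
agree-∨ {φ} {ψ} ihφ ihψ Γ σ τ U m = ⇔I
  (Dense-elim U (hyp (there m)) (cong₂ _∨̇_ (at₁ φ) (at₁ ψ)) #0
     (cast (sym (wkSF-subst σ τ (φ ∨̇ ψ)))
           (∨E #0 (∨I₁ (forced⇒ ihφ (svar 0) (there (there (here refl))) #0))
                  (∨I₂ (forced⇒ ihψ (svar 0) (there (there (here refl))) #0)))))
  (Dense-intro U (cong₂ _∨̇_ (at₀ φ) (at₀ ψ))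
     (∨E (cast (wkSF-subst σ τ (φ ∨̇ ψ)) #2)
         (∨I₁ (⇒forced ihφ (svar 0) (there (here refl)) #0))
         (∨I₂ (⇒forced ihψ (svar 0) (there (here refl)) #0))))
  where
  at₁ : ∀ χ → substF var (liftS (U ▸ svar)) (force χ σ (wkS ∘ wkS ∘ τ) (svar 0))
                ≡ force χ σ (wkS ∘ τ) (svar 0)
  at₁ χ = force-subst χ (substT-var ∘ σ) (wkS²-inst-at₁ τ U) (svar 0)
  at₀ : ∀ χ → substF var (svar 0 ▸ svar) (force χ σ (wkS ∘ wkS ∘ τ) (svar 0))
                ≡ force χ σ (wkS ∘ τ) (svar 0)
  at₀ χ = force-subst χ (substT-var ∘ σ) (wkS²-inst-at₀ τ) (svar 0)

agree-∀ : Agreement φ → Agreement (∀̇ φ)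
agree-∀ ih Γ σ τ U m = ⇔I
  (∀I (forced⇒ ih (wkNS U) (there (Ult-wkN U m)) (∀E₀ #0)))
  (∀I (⇒forced ih (wkNS U) (there (Ult-wkN U m)) (∀E₀ #0)))

-- wkNF (Ult (svar 0)) and wkSF (Ult (svar 0)) are Ult (svar 0) and Ult (svar 1)
-- definitionally, which is what the bare membership proofs in the ∃ and ∃²
-- cases rely on.
agree-∃ : Agreement φ → Agreement (∃̇ φ)
agree-∃ {φ} ih Γ σ τ U m = ⇔I
  (Dense-elim U (hyp (there m))
     (cong ∃̇ (force-subst φ hσ (wkNS-∘ (wkS ∘ wkS ∘ τ) (wkS²-inst-at₁ τ U)) (svar 0))) #0
     (cast (sym (wkSF-subst σ τ (∃̇ φ)))
           (∃E #0 (∃I₀ (forced⇒ ih (svar 0) (there (there (here refl))) #0)))))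
  (Dense-intro U
     (cong ∃̇ (force-subst φ hσ (wkNS-∘ (wkS ∘ wkS ∘ τ) (wkS²-inst-at₀ τ)) (svar 0)))
     (∃E (cast (wkSF-subst σ τ (∃̇ φ)) #2)
         (∃I₀ (⇒forced ih (svar 0) (there (here refl)) #0))))
  where hσ = liftN-∘ (substT-var ∘ σ)

agree-∀² : Agreement φ → Agreement (∀² φ)
agree-∀² ih Γ σ τ U m = ⇔I
  (∀²I (forced⇒ ih (wkS U) (there (Ult-wkS U m)) (∀²E₀ #0)))
  (∀²I (⇒forced ih (wkS U) (there (Ult-wkS U m)) (∀²E₀ #0)))

agree-∃² : Agreement φ → Agreement (∃² φ)
agree-∃² {φ} ih Γ σ τ U m = ⇔I
  (Dense-elim U (hyp (there m))
     (cong ∃² (force-subst φ (substT-var ∘ σ) (liftS-∘ (wkS²-inst-at₁ τ U)) (svar 1))) #0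
     (cast (sym (wkSF-subst σ τ (∃² φ)))
           (∃²E #0 (∃²I₀ (forced⇒ ih (svar 1) (there (there (here refl))) #0)))))
  (Dense-intro U
     (cong ∃² (force-subst φ (substT-var ∘ σ) (liftS-∘ (wkS²-inst-at₀ τ)) (svar 1)))
     (∃²E (cast (wkSF-subst σ τ (∃² φ)) #2)
          (∃²I₀ (⇒forced ih (svar 1) (there (here refl)) #0))))

NoU-subst : ∀ σ τ → NoU φ → NoU (substF σ τ φ)
NoU-subst σ τ eq         = eq
NoU-subst σ τ lt         = lt
NoU-subst σ τ mem        = mem
NoU-subst σ τ (neg n)    = neg (NoU-subst σ τ n)
NoU-subst σ τ (and n m)  = and (NoU-subst σ τ n) (NoU-subst σ τ m)
NoU-subst σ τ (or n m)   = or (NoU-subst σ τ n) (NoU-subst σ τ m)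
NoU-subst σ τ (imp n m)  = imp (NoU-subst σ τ n) (NoU-subst σ τ m)
NoU-subst σ τ (all n)    = all (NoU-subst _ _ n)
NoU-subst σ τ (ex n)     = ex (NoU-subst _ _ n)
NoU-subst σ τ (all² n)   = all² (NoU-subst _ _ n)
NoU-subst σ τ (ex² n)    = ex² (NoU-subst _ _ n)

agreement : NoU φ → Agreement φ
agreement eq          _ _ _ _ _ = ⇔I #0 #0
agreement lt          _ _ _ _ _ = ⇔I #0 #0
agreement mem         _ _ _ _ _ = ⇔I #0 #0
agreement (neg n)     = agree-¬ (agreement n)
agreement (and n₁ n₂) = agree-∧ (agreement n₁) (agreement n₂)
agreement (or n₁ n₂)  = agree-∨ (agreement n₁) (agreement n₂)
agreement (imp n₁ n₂) = agree-⇒ (agreement n₁) (agreement n₂)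
agreement (all n)     = agree-∀ (agreement n)
agreement (ex n)      = agree-∃ (agreement n)
agreement (all² n)    = agree-∀² (agreement n)
agreement (ex² n)     = agree-∃² (agreement n)

mainTheorem6 : (φ : Fm) → NoU φ →
    RCA₀⊢ ∀² (Ult (svar 0) ⇒ ((svar 0 ⊩ wkSF φ) ⇔ wkSF φ))
mainTheorem6 φ n =
  ∀²I (⇒I (cast (cong (svar 0 ⊩ wkSF φ ⇔_) (substF-id (λ _ → refl) (λ _ → refl) (wkSF φ)))
                (agreement (NoU-subst var (svar ∘ suc) n) _ var svar (svar 0) (here refl))))
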